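{- In the hitting game on a line (defined in the context), there is a universal constant $c>0$ such that for every $k\ge 2$ and every deterministic online algorithm $\mathrm{DET}$ there exist request sequences on which the cost of $\mathrm{DET}$ is at least $c\cdot k\cdot \mathrm{OPT}$, where $\mathrm{OPT}$ is the cost of an optimal static strategy on that sequence; i.e., every deterministic online algorithm has competitive ratio $\Omega(k)$ against the optimal static strategy.
   Context: Hitting game on a line: a line with nodes $v_1,\dots,v_{k+1}$ and edges $e_i=\{v_i,v_{i+1}\}$, $1\le i\le k$, is given, with distance $d(e_i,e_j)=|i-j|$. The player's initial position is the central edge $e_s$, $s=\lceil k/2\rceil$. In each time step $t=1,\dots,N$ an edge $e\in\{e_1,\dots,e_k\}$ is requested. If the player's current position is $e$, it may stay there and pay $1$ (hitting cost), or alternatively change its position and pay the traveled distance (moving cost); in general moving from $e_i$ to $e_j$ costs $|i-j|$. An optimal static strategy chooses one position $e_p$ at the beginning, pays $|s-p|$, stays there for all requests, and pays $1$ for each request to $e_p$; $\mathrm{OPT}$ is the minimum cost of such a static strategy. -}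

module Defs where

open import Data.Nat using (ℕ; zero; suc; _+_; _∸_; _/_; _⊓_; ∣_-_∣)
open import Data.Fin using (Fin; toℕ; _≟_)
open import Data.List using (List; []; _∷_; _++_; [_]; length; filter; allFin)
open import Relation.Nullary using (does)
open import Data.Bool using (if_then_else_)

-- Edges e_1..e_k are represented by Fin k, with e_i ↦ i-1 (0-indexed).
-- Distance d(e_i,e_j) = |i - j| (computed on the 0-indexed values).

-- Initial position e_s with s = ⌈k/2⌉ (1-indexed), i.e. index ⌈k/2⌉ - 1 = ⌊(k-1)/2⌋.
start : ℕ → ℕ
start k = (k ∸ 1) / 2

-- A deterministic online algorithm: given the sequence of requests so far
-- (the last element being the current request), it returns the position it
-- occupies after serving the current request.  Its own past positions are
-- determined by the prefixes, so this covers all deterministic online algorithms.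
Alg : ℕ → Set
Alg k = List (Fin k) → Fin k

hit : ∀ {k} → Fin k → Fin k → ℕ
hit e q = if does (e ≟ q) then 1 else 0

runCost : ∀ {k} → Alg k → ℕ → List (Fin k) → List (Fin k) → ℕ
runCost A pos hist [] = 0
runCost A pos hist (e ∷ rest) =
  ∣ pos - toℕ (A (hist ++ [ e ])) ∣ + hit e (A (hist ++ [ e ]))
    + runCost A (toℕ (A (hist ++ [ e ]))) (hist ++ [ e ]) rest

cost : (k : ℕ) → Alg k → List (Fin k) → ℕ
cost k A σ = runCost A (start k) [] σ

count : ∀ {k} → Fin k → List (Fin k) → ℕ
count p σ = length (filter (λ e → e ≟ p) σ)

staticCost : (k : ℕ) → Fin k → List (Fin k) → ℕ
staticCost k p σ = ∣ start k - toℕ p ∣ + count p σ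

-- minimum of a list of naturals (0 for the empty list; never used for k ≥ 1)
minList : List ℕ → ℕ
minList [] = 0
minList (x ∷ []) = x
minList (x ∷ y ∷ ys) = x ⊓ minList (y ∷ ys)

mapL : ∀ {A B : Set} → (A → B) → List A → List B
mapL f [] = []
mapL f (x ∷ xs) = f x ∷ mapL f xs

OPT : (k : ℕ) → List (Fin k) → ℕ
OPT k σ = minList (mapL (λ p → staticCost k p σ) (allFin k))

{-# OPTIONS --safe #-}
-- The adversary first requests every edge B times, so that every static
-- strategy, hence OPT, pays at least B.  It then makes N = k(k + B) + 1
-- requests, each to the edge the algorithm currently occupies, so the
-- algorithm pays at least 1 per request (it either stays and is hit, or
-- moves), except possibly the first: cost ≥ N - 1.  Averaging the static
-- strategies, k·OPT ≤ Σₚ (k + B + #requests to p) = k(k + B) + N ≤ 3(N - 1).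
module Submission where

open import Defs
open import Data.Nat using (ℕ; zero; suc; _+_; _*_; _∸_; _⊔_; ∣_-_∣; _≤_; z≤n; s≤s)
open import Data.Nat.Properties hiding (_≟_)
open import Data.Nat.DivMod using (m/n≤m)
open import Data.Fin using (Fin; toℕ; _≟_) renaming (zero to fzero; suc to fsuc)
open import Data.Fin.Properties using (toℕ-injective; toℕ<n)
open import Data.List using (List; []; _∷_; _++_; [_]; map; length; filter; concat; replicate; allFin; tabulate)
open import Data.List.Properties using (++-assoc; ++-identityʳ; length-++; filter-++)
open import Data.List.Membership.Propositional using (_∈_)
open import Data.List.Membership.Propositional.Properties using (∈-map⁺; ∈-allFin)
open import Data.List.Relation.Unary.All using (All; []; _∷_)
open import Data.List.Relation.Unary.All.Properties using (map⁺; tabulate⁺)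
open import Data.List.Relation.Unary.Any using (here; there)
open import Data.Product using (Σ; _×_; _,_)
open import Data.Vec.Functional using (Vector)
open import Relation.Nullary using (yes; no)
open import Relation.Binary.PropositionalEquality hiding ([_])
open import Data.Empty using (⊥-elim)
open import Function using (id; _∘_)
open import Algebra.Properties.CommutativeMonoid.Sum +-0-commutativeMonoid
  using (sum; sum-syntax; ∑-distrib-+; sum-cong-≗; sum-replicate-zero)

m+1+m≤3*m : ∀ {m} → 1 ≤ m → m + suc m ≤ 3 * m
m+1+m≤3*m {m} 1≤m = begin
  m + suc m        ≤⟨ +-monoʳ-≤ m (+-monoˡ-≤ m 1≤m) ⟩
  m + (m + m)      ≡⟨ cong (λ x → m + (m + x)) (+-identityʳ m) ⟨
  3 * m            ∎
  where open ≤-Reasoning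

∑-const : ∀ n c → ∑[ i < n ] c ≡ n * c
∑-const zero    c = refl
∑-const (suc n) c = cong (c +_) (∑-const n c)

∑-mono-≤ : ∀ {n} {f g : Vector ℕ n} → (∀ i → f i ≤ g i) → sum f ≤ sum g
∑-mono-≤ {zero}  f≤g = z≤n
∑-mono-≤ {suc n} f≤g = +-mono-≤ (f≤g fzero) (∑-mono-≤ (λ i → f≤g (fsuc i)))

minList-≤ : ∀ {x xs} → x ∈ xs → minList xs ≤ x
minList-≤ {xs = _ ∷ []}     (here refl) = ≤-refl
minList-≤ {xs = _ ∷ _ ∷ _}  (here refl) = m⊓n≤m _ _
minList-≤ {xs = y ∷ _ ∷ _}  (there x∈) = ≤-trans (m⊓n≤n y _) (minList-≤ x∈)

≤-minList : ∀ {b x xs} → All (b ≤_) (x ∷ xs) → b ≤ minList (x ∷ xs)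
≤-minList (b≤x ∷ [])          = b≤x
≤-minList (b≤x ∷ b≤xs@(_ ∷ _)) = ⊓-glb b≤x (≤-minList b≤xs)

hit-sym : ∀ {k} (e q : Fin k) → hit e q ≡ hit q e
hit-sym e q with e ≟ q | q ≟ e
... | yes _   | yes _   = refl
... | no _    | no _    = refl
... | yes e≡q | no q≢e  = ⊥-elim (q≢e (sym e≡q))
... | no e≢q  | yes q≡e = ⊥-elim (e≢q (sym q≡e))

∑-hit : ∀ {k} (e : Fin k) → sum (hit e) ≡ 1
∑-hit {suc k} fzero    = cong suc (sum-replicate-zero k)
∑-hit {suc k} (fsuc e) = ∑-hit e

count-∷ : ∀ {k} (p e : Fin k) σ → count p (e ∷ σ) ≡ hit e p + count p σ
count-∷ p e σ with e ≟ p
... | yes _ = refl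
... | no _  = refl

count-++ : ∀ {k} (p : Fin k) xs ys → count p (xs ++ ys) ≡ count p xs + count p ys
count-++ p xs ys = trans (cong length (filter-++ (_≟ p) xs ys)) (length-++ (filter (_≟ p) xs))

count-tabulate : ∀ {k n} (p : Fin k) (f : Fin n → Fin k) → count p (tabulate f) ≡ sum (λ i → hit (f i) p)
count-tabulate {n = zero}  p f = refl
count-tabulate {n = suc n} p f =
  trans (count-∷ p (f fzero) (tabulate (f ∘ fsuc))) (cong (hit (f fzero) p +_) (count-tabulate p (f ∘ fsuc)))

count-allFin : ∀ {k} (p : Fin k) → count p (allFin k) ≡ 1
count-allFin p = begin
  count p (allFin _)       ≡⟨ count-tabulate p id ⟩
  sum (λ i → hit i p)      ≡⟨ sum-cong-≗ (λ i → hit-sym i p) ⟩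
  sum (hit p)              ≡⟨ ∑-hit p ⟩
  1                        ∎
  where open ≡-Reasoning

∑-count : ∀ k (σ : List (Fin k)) → ∑[ p < k ] count p σ ≡ length σ
∑-count k []      = sum-replicate-zero k
∑-count k (e ∷ σ) = begin
  sum (λ p → count p (e ∷ σ))          ≡⟨ sum-cong-≗ (λ p → count-∷ p e σ) ⟩
  sum (λ p → hit e p + count p σ)      ≡⟨ ∑-distrib-+ (hit e) (λ p → count p σ) ⟩
  sum (hit e) + sum (λ p → count p σ)  ≡⟨ cong₂ _+_ (∑-hit e) (∑-count k σ) ⟩
  suc (length σ)                       ∎
  where open ≡-Reasoning

mapL≡map : ∀ {A B : Set} (f : A → B) xs → mapL f xs ≡ map f xs
mapL≡map f []       = refl
mapL≡map f (x ∷ xs) = cong (f x ∷_) (mapL≡map f xs)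

OPT≡minList : ∀ k σ → OPT k σ ≡ minList (map (λ p → staticCost k p σ) (allFin k))
OPT≡minList k σ = cong minList (mapL≡map _ (allFin k))

OPT≤staticCost : ∀ {k} σ (p : Fin k) → OPT k σ ≤ staticCost k p σ
OPT≤staticCost {k} σ p rewrite OPT≡minList k σ = minList-≤ (∈-map⁺ _ (∈-allFin p))

≤-OPT : ∀ {n b} σ → (∀ p → b ≤ staticCost (suc n) p σ) → b ≤ OPT (suc n) σ
≤-OPT {n} σ b≤ rewrite OPT≡minList (suc n) σ = ≤-minList (map⁺ (tabulate⁺ b≤))

*-OPT≤∑-staticCost : ∀ k σ → k * OPT k σ ≤ ∑[ p < k ] staticCost k p σ
*-OPT≤∑-staticCost k σ = begin
  k * OPT k σ                      ≡⟨ ∑-const k (OPT k σ) ⟨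
  ∑[ p < k ] OPT k σ               ≤⟨ ∑-mono-≤ (OPT≤staticCost σ) ⟩
  ∑[ p < k ] staticCost k p σ      ∎
  where open ≤-Reasoning

staticCost≤ : ∀ {k} (p : Fin k) σ → staticCost k p σ ≤ k + count p σ
staticCost≤ {k} p σ = +-monoˡ-≤ (count p σ) (begin
  ∣ start k - toℕ p ∣   ≤⟨ ∣m-n∣≤m⊔n (start k) (toℕ p) ⟩
  start k ⊔ toℕ p       ≤⟨ ⊔-lub (≤-trans (m/n≤m (k ∸ 1) 2) (m∸n≤m k 1)) (<⇒≤ (toℕ<n p)) ⟩
  k                     ∎)
  where open ≤-Reasoning hiding (start)

rounds : ∀ k → ℕ → List (Fin k)
rounds k b = concat (replicate b (allFin k))

count-rounds : ∀ {k} (p : Fin k) b → count p (rounds k b) ≡ b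
count-rounds p zero    = refl
count-rounds p (suc b) =
  trans (count-++ p (allFin _) (rounds _ b)) (cong₂ _+_ (count-allFin p) (count-rounds p b))

chase : ∀ {k} → Alg k → List (Fin k) → Fin k → ℕ → List (Fin k)
chase A hist e zero    = []
chase A hist e (suc n) = e ∷ chase A (hist ++ [ e ]) (A (hist ++ [ e ])) n

length-chase : ∀ {k} (A : Alg k) hist e n → length (chase A hist e n) ≡ n
length-chase A hist e zero    = refl
length-chase A hist e (suc n) = cong suc (length-chase A _ _ n)

move-or-hit : ∀ {k} (e a : Fin k) → 1 ≤ ∣ toℕ e - toℕ a ∣ + hit e a
move-or-hit e a with e ≟ a
... | yes _ = m≤n+m 1 _
... | no e≢a with ∣ toℕ e - toℕ a ∣ in d≡
...   | zero  = ⊥-elim (e≢a (toℕ-injective (∣m-n∣≡0⇒m≡n d≡)))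
...   | suc _ = s≤s z≤n

runCost-chase : ∀ {k} (A : Alg k) hist e n → n ≤ runCost A (toℕ e) hist (chase A hist e n)
runCost-chase A hist e zero    = z≤n
runCost-chase A hist e (suc n) =
  +-mono-≤ (move-or-hit e (A (hist ++ [ e ]))) (runCost-chase A (hist ++ [ e ]) (A (hist ++ [ e ])) n)

-- From an arbitrary position the first request may be free; all later ones are not.
runCost-chase-from : ∀ {k} (A : Alg k) pos hist e n → n ≤ suc (runCost A pos hist (chase A hist e n))
runCost-chase-from A pos hist e zero    = z≤n
runCost-chase-from A pos hist e (suc n) =
  s≤s (≤-trans (runCost-chase A (hist ++ [ e ]) (A (hist ++ [ e ])) n) (m≤n+m _ _))

runCost-suffix : ∀ {k} (A : Alg k) pos hist xs ys →
  Σ ℕ (λ q → runCost A q (hist ++ xs) ys ≤ runCost A pos hist (xs ++ ys))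
runCost-suffix A pos hist [] ys rewrite ++-identityʳ hist = pos , ≤-refl
runCost-suffix A pos hist (x ∷ xs) ys
  with q , ≤cost ← runCost-suffix A (toℕ (A (hist ++ [ x ]))) (hist ++ [ x ]) xs ys
  rewrite ++-assoc hist [ x ] xs = q , ≤-trans ≤cost (m≤n+m _ _)

cost-++-chase : ∀ {k} (A : Alg k) prefix e n → n ≤ suc (cost k A (prefix ++ chase A prefix e n))
cost-++-chase {k} A prefix e n with q , ≤cost ← runCost-suffix A (start k) [] prefix (chase A prefix e n) =
  ≤-trans (runCost-chase-from A q prefix e n) (s≤s ≤cost)

module Adversary {n : ℕ} (A : Alg (suc n)) (B : ℕ) where

  K X : ℕ
  K = suc n
  X = K * (K + B)

  chasing requests : List (Fin K)
  chasing  = chase A (rounds K B) fzero (suc X)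
  requests = rounds K B ++ chasing

  count-requests : ∀ p → count p requests ≡ B + count p chasing
  count-requests p = trans (count-++ p (rounds K B) chasing) (cong (_+ count p chasing) (count-rounds p B))

  B≤OPT : B ≤ OPT K requests
  B≤OPT = ≤-OPT requests λ p →
    ≤-trans (m≤m+n B _) (≤-trans (≤-reflexive (sym (count-requests p))) (m≤n+m _ _))

  X≤cost : X ≤ cost K A requests
  X≤cost = ≤-pred (cost-++-chase A (rounds K B) fzero (suc X))

  K*OPT≤X+1+X : K * OPT K requests ≤ X + suc X
  K*OPT≤X+1+X = begin
    K * OPT K requests                          ≤⟨ *-OPT≤∑-staticCost K requests ⟩
    ∑[ p < K ] staticCost K p requests          ≤⟨ ∑-mono-≤ staticCost≤K+B+count ⟩
    ∑[ p < K ] ((K + B) + count p chasing)      ≡⟨ ∑-distrib-+ (λ _ → K + B) (λ p → count p chasing) ⟩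
    ∑[ p < K ] (K + B) + ∑[ p < K ] count p chasing
                                                ≡⟨ cong₂ _+_ (∑-const K (K + B)) (∑-count K chasing) ⟩
    X + length chasing                          ≡⟨ cong (X +_) (length-chase A (rounds K B) fzero (suc X)) ⟩
    X + suc X                                   ∎
    where
    open ≤-Reasoning
    staticCost≤K+B+count : ∀ p → staticCost K p requests ≤ (K + B) + count p chasing
    staticCost≤K+B+count p = ≤-trans (staticCost≤ p requests)
      (≤-reflexive (trans (cong (K +_) (count-requests p)) (sym (+-assoc K B _))))

lemma5 : Σ ℕ (λ d → (1 ≤ d) × ((k : ℕ) → 2 ≤ k → (A : Alg k) → (B : ℕ) →
           Σ (List (Fin k)) (λ σ → (B ≤ OPT k σ) × (k * OPT k σ ≤ d * cost k A σ))))
lemma5 = 3 , s≤s z≤n , λ where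
  (suc n) _ A B → let open Adversary A B in   -- k ≥ 1 already suffices
    requests , B≤OPT ,
    ≤-trans K*OPT≤X+1+X (≤-trans (m+1+m≤3*m (s≤s z≤n)) (*-monoʳ-≤ 3 X≤cost))
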